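{- Let $m\ge 2$ be an integer. Then for all $j\ge 0$: (i) $sp(2mj+1,m)\equiv 1\pmod 4$, and (ii) $sp(2mj+m+1,m)\equiv 3\pmod 4$.
   Context: For fixed $m>1$, $sp(n,m)$ is defined by: $sp(n,m)=0$ for $n<0$, $sp(0,m)=1$, $sp(n,m)=1$ for $1\le n\le m-1$, and for $n\ge m$: $sp(n,m)=sp(n/m,m)$ if $m\mid n$, and $sp(n,m)=2sp(n-r,m)+sp(n-m,m)$ if $n\equiv r\pmod m$ with $0<r<m$. (It counts semi-$m$-Pell compositions of $n$.) -}

module Defs where

open import Data.Nat using (ℕ; zero; suc; _+_; _*_; _∸_; _<ᵇ_)
open import Data.Nat.DivMod using (_/_; _%_)
open import Data.Bool using (if_then_else_)

-- Each recursive call strictly decreases n (n/m < n, n - r < n, n - m < n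
-- for n ≥ m ≥ 2), so fuel n + 1 is always sufficient; fuel 0 is never
-- reached from spAux (suc n) n.
-- sp(n,m) = 1 for 0 ≤ n ≤ m-1;
-- for n ≥ m: if r = n mod m is 0 then sp(n/m) else 2 sp(n - r) + sp(n - m).
spAux : ℕ → (k : ℕ) → ℕ → ℕ
spAux zero k n = 0
spAux (suc f) k n =
  if n <ᵇ (suc (suc k)) then 1
  else (let r = n % (suc (suc k)) in
        if r <ᵇ 1 then spAux f k (n / (suc (suc k)))
        else 2 * spAux f k (n ∸ r) + spAux f k (n ∸ (suc (suc k))))

-- sp(n, m) for m ≥ 2; for m < 2 (outside the paper's scope) it is set to 0.
-- (Natural-number n only: sp(n,m) = 0 for n < 0 is never reached here,
-- since the recursion only calls sp on n - r, n - m ≥ 0 when n ≥ m.)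
sp : ℕ → ℕ → ℕ
sp n zero = 0
sp n (suc zero) = 0
sp n (suc (suc k)) = spAux (suc n) k n

-- Every value sp(n, m) is odd: the base value is 1, the case m ∣ n recurses,
-- and otherwise sp(n) = 2 sp(n - r) + sp(n - m) is even plus odd.  For
-- n = qm + 1 with q ≥ 1 the remainder is 1, so sp(qm + 1) = 2 sp(qm) +
-- sp((q-1)m + 1) ≡ 2 + sp((q-1)m + 1) (mod 4) because sp(qm) is odd.
-- Hence sp(qm + 1) ≡ 1 + 2q (mod 4), which is 1 for even q and 3 for odd q.
module Submission where

open import Defs
open import Data.Nat using (ℕ; _+_; _*_; _%_; _≥_)
open import Data.Product using (_×_)
open import Relation.Binary.PropositionalEquality using (_≡_)

open import Data.Nat
  using (NonZero; >-nonZero; suc; _∸_; _/_; _<_; _≤_; _<ᵇ_; _<?_; _≟_; z≤n; s≤s; s≤s⁻¹)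
open import Data.Nat.Properties
open import Data.Nat.DivMod
open import Data.Nat.Divisibility using (m∣m*n)
open import Data.Nat.Induction using (<-rec)
open import Data.Nat.Tactic.RingSolver using (solve-∀)
open import Data.Bool using (true; false)
open import Data.Product using (_,_)
open import Relation.Nullary using (yes; no; ofʸ; ofⁿ; contradiction)
open import Relation.Binary.PropositionalEquality
  using (refl; sym; trans; cong; cong₂; subst; module ≡-Reasoning)
open ≡-Reasoning

%-cong-+ˡ : ∀ c a b d .{{_ : NonZero d}} → a % d ≡ b % d → (c + a) % d ≡ (c + b) % d
%-cong-+ˡ c a b d a≡b = begin
  (c + a) % d             ≡⟨ %-distribˡ-+ c a d ⟩
  (c % d + a % d) % d     ≡⟨ cong (λ t → (c % d + t) % d) a≡b ⟩
  (c % d + b % d) % d     ≡⟨ %-distribˡ-+ c b d ⟨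
  (c + b) % d             ∎

[2*a+b]%2≡b%2 : ∀ a b → (2 * a + b) % 2 ≡ b % 2
[2*a+b]%2≡b%2 a b = %-remove-+ˡ b (m∣m*n a)

[2*odd+b]%4≡[2+b]%4 : ∀ {a} b → a % 2 ≡ 1 → (2 * a + b) % 4 ≡ (2 + b) % 4
[2*odd+b]%4≡[2+b]%4 {a} b a%2≡1 = begin
  (2 * a + b) % 4                 ≡⟨ cong (λ t → (2 * t + b) % 4) a≡1+h*2 ⟩
  (2 * (1 + h * 2) + b) % 4       ≡⟨ cong (_% 4) (regroup h b) ⟩
  (2 + b + h * 4) % 4             ≡⟨ [m+kn]%n≡m%n (2 + b) h 4 ⟩
  (2 + b) % 4                     ∎
  where
  h : ℕ
  h = a / 2
  a≡1+h*2 : a ≡ 1 + h * 2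
  a≡1+h*2 = trans (m≡m%n+[m/n]*n a 2) (cong (_+ h * 2) a%2≡1)
  regroup : ∀ x y → 2 * (1 + x * 2) + y ≡ 2 + y + x * 4
  regroup = solve-∀

m∸n<m : ∀ {m n} → 0 < n → n ≤ m → m ∸ n < m
m∸n<m {m} 0<n n≤m = ∸-monoʳ-< {m} 0<n n≤m

<-<-suc⇒< : ∀ {x n f} → x < n → n < suc f → x < f
<-<-suc⇒< x<n n<1+f = <-≤-trans x<n (s≤s⁻¹ n<1+f)

module SemiPell (k : ℕ) where

  m : ℕ
  m = 2 + k

  /-descent : ∀ {n} → m ≤ n → n / m < n
  /-descent {n} m≤n = m/n<m n m {{>-nonZero (≤-trans (s≤s z≤n) m≤n)}} (s≤s (s≤s z≤n))

  spAux-fuel : ∀ {f g n} → n < f → n < g → spAux f k n ≡ spAux g k n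
  spAux-fuel {suc f} {suc g} {n} n<f n<g with n <ᵇ m | <ᵇ-reflects-< n m
  ... | true  | _ = refl
  ... | false | ofⁿ n≮m with n % m <ᵇ 1 | <ᵇ-reflects-< (n % m) 1
  ... | true  | _ = spAux-fuel (<-<-suc⇒< (/-descent (≮⇒≥ n≮m)) n<f)
                               (<-<-suc⇒< (/-descent (≮⇒≥ n≮m)) n<g)
  ... | false | ofⁿ r≮1 = cong₂ (λ a b → 2 * a + b)
      (spAux-fuel (<-<-suc⇒< (m∸n<m (≮⇒≥ r≮1) (m%n≤m n m)) n<f)
                  (<-<-suc⇒< (m∸n<m (≮⇒≥ r≮1) (m%n≤m n m)) n<g))
      (spAux-fuel (<-<-suc⇒< (m∸n<m (s≤s z≤n) (≮⇒≥ n≮m)) n<f)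
                  (<-<-suc⇒< (m∸n<m (s≤s z≤n) (≮⇒≥ n≮m)) n<g))

  sp-small : ∀ {n} → n < m → sp n m ≡ 1
  sp-small {n} n<m with n <ᵇ m | <ᵇ-reflects-< n m
  ... | true  | _        = refl
  ... | false | ofⁿ n≮m = contradiction n<m n≮m

  sp-multiple : ∀ {n} → m ≤ n → n % m ≡ 0 → sp n m ≡ sp (n / m) m
  sp-multiple {n} m≤n r≡0 with n <ᵇ m | <ᵇ-reflects-< n m
  ... | true  | ofʸ n<m = contradiction n<m (≤⇒≯ m≤n)
  ... | false | _ rewrite r≡0 = spAux-fuel (/-descent m≤n) ≤-refl

  sp-nonmultiple : ∀ {n} → m ≤ n → 0 < n % m →
                   sp n m ≡ 2 * sp (n ∸ n % m) m + sp (n ∸ m) m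
  sp-nonmultiple {n} m≤n 0<r with n <ᵇ m | <ᵇ-reflects-< n m
  ... | true  | ofʸ n<m = contradiction n<m (≤⇒≯ m≤n)
  ... | false | _ with n % m <ᵇ 1 | <ᵇ-reflects-< (n % m) 1
  ... | true  | ofʸ r<1 = contradiction 0<r (<⇒≱ r<1)
  ... | false | _ = cong₂ (λ a b → 2 * a + b)
      (spAux-fuel (m∸n<m 0<r (m%n≤m n m)) ≤-refl)
      (spAux-fuel (m∸n<m (s≤s z≤n) m≤n) ≤-refl)

  sp-odd : ∀ n → sp n m % 2 ≡ 1
  sp-odd = <-rec (λ n → sp n m % 2 ≡ 1) step
    where
    step : ∀ n → (∀ {x} → x < n → sp x m % 2 ≡ 1) → sp n m % 2 ≡ 1
    step n ih with n <? m
    ... | yes n<m = cong (_% 2) (sp-small n<m)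
    ... | no n≮m with n % m ≟ 0
    ... | yes r≡0 = trans (cong (_% 2) (sp-multiple (≮⇒≥ n≮m) r≡0)) (ih (/-descent (≮⇒≥ n≮m)))
    ... | no r≢0 = begin
      sp n m % 2                                      ≡⟨ cong (_% 2) (sp-nonmultiple (≮⇒≥ n≮m) (n≢0⇒n>0 r≢0)) ⟩
      (2 * sp (n ∸ n % m) m + sp (n ∸ m) m) % 2       ≡⟨ [2*a+b]%2≡b%2 (sp (n ∸ n % m) m) (sp (n ∸ m) m) ⟩
      sp (n ∸ m) m % 2                                ≡⟨ ih (m∸n<m (s≤s z≤n) (≮⇒≥ n≮m)) ⟩
      1                                               ∎

  sp[qm+1]%4 : ∀ q → sp (q * m + 1) m % 4 ≡ (1 + 2 * q) % 4
  sp[qm+1]%4 0 = cong (_% 4) (sp-small (s≤s (s≤s z≤n)))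
  sp[qm+1]%4 (suc q) = begin
    sp n m % 4                                        ≡⟨ cong (_% 4) (sp-nonmultiple m≤n 0<n%m) ⟩
    (2 * sp (n ∸ n % m) m + sp (n ∸ m) m) % 4         ≡⟨ [2*odd+b]%4≡[2+b]%4 {sp (n ∸ n % m) m} (sp (n ∸ m) m) (sp-odd (n ∸ n % m)) ⟩
    (2 + sp (n ∸ m) m) % 4                            ≡⟨ cong (λ t → (2 + sp t m) % 4) n∸m≡qm+1 ⟩
    (2 + sp (q * m + 1) m) % 4                        ≡⟨ %-cong-+ˡ 2 (sp (q * m + 1) m) (1 + 2 * q) 4 (sp[qm+1]%4 q) ⟩
    (2 + (1 + 2 * q)) % 4                             ≡⟨ cong (_% 4) (step q) ⟩
    (1 + 2 * suc q) % 4                               ∎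
    where
    n : ℕ
    n = suc q * m + 1
    m≤n : m ≤ n
    m≤n = ≤-trans (m≤m+n m (q * m)) (m≤m+n _ 1)
    0<n%m : 0 < n % m
    0<n%m = subst (0 <_) (sym n%m≡1) (s≤s z≤n)
      where
      n%m≡1 : n % m ≡ 1
      n%m≡1 = trans (cong (_% m) (+-comm (suc q * m) 1)) ([m+kn]%n≡m%n 1 (suc q) m)
    n∸m≡qm+1 : n ∸ m ≡ q * m + 1
    n∸m≡qm+1 = trans (cong (_∸ m) (+-assoc m (q * m) 1)) (m+n∸m≡n m (q * m + 1))
    step : ∀ q → 2 + (1 + 2 * q) ≡ 1 + 2 * suc q
    step = solve-∀

theorem4p2 : (m : ℕ) → m ≥ 2 → (j : ℕ) →
    (sp (2 * m * j + 1) m % 4 ≡ 1) × (sp (2 * m * j + m + 1) m % 4 ≡ 3)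
theorem4p2 (suc 0) (s≤s ()) j
theorem4p2 (suc (suc k)) _ j =
    residue (2 * j)     (even-index (2 + k) j) (even-residue j)
  , residue (2 * j + 1) (odd-index (2 + k) j)  (odd-residue j)
  where
  open SemiPell k using (m; sp[qm+1]%4)
  residue : ∀ {n r} q → n ≡ q * m + 1 → 1 + 2 * q ≡ r + j * 4 → sp n m % 4 ≡ r % 4
  residue {n} {r} q refl 1+2q≡r+4j = begin
    sp n m % 4            ≡⟨ sp[qm+1]%4 q ⟩
    (1 + 2 * q) % 4       ≡⟨ cong (_% 4) 1+2q≡r+4j ⟩
    (r + j * 4) % 4       ≡⟨ [m+kn]%n≡m%n r j 4 ⟩
    r % 4                 ∎
  even-index : ∀ m j → 2 * m * j + 1 ≡ 2 * j * m + 1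
  even-index = solve-∀
  odd-index : ∀ m j → 2 * m * j + m + 1 ≡ (2 * j + 1) * m + 1
  odd-index = solve-∀
  even-residue : ∀ j → 1 + 2 * (2 * j) ≡ 1 + j * 4
  even-residue = solve-∀
  odd-residue : ∀ j → 1 + 2 * (2 * j + 1) ≡ 3 + j * 4
  odd-residue = solve-∀
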